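{- Let $\mathcal{P},\mathcal{Q}$ be partitions of the same finite set with $\mathcal{P}$ equitable. If $\mathcal{Q}\prec_{1/2}\mathcal{P}$, then $|\mathcal{Q}|\ge\frac14|\mathcal{P}|$.
   Context: A partition is equitable if all its members have the same size. For sets $S,T$ write $S\subseteq_\beta T$ if $|S\setminus T|<\beta|S|$; $S\in_\beta\mathcal{P}$ if $S\subseteq_\beta P$ for some $P\in\mathcal{P}$. For partitions $\mathcal{P},\mathcal{Q}$ of a common $n$-element set, $\mathcal{Q}\prec_\beta\mathcal{P}$ if $\sum_{Q\in\mathcal{Q},\,Q\notin_\beta\mathcal{P}}|Q|\le\beta n$. -}

module Defs where

open import Data.Nat using (ℕ; _+_; _*_; _<_; _≤_; _<?_)
open import Data.Fin using (Fin)
open import Data.Fin.Subset using (Subset; _∈_; _─_; ∣_∣; Nonempty)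
open import Data.List using (List; length; lookup; filter; map)
open import Data.Nat.ListAction using (sum)
open import Data.List.Relation.Unary.All using (All)
open import Data.List.Relation.Unary.Any using (Any; any?)
open import Data.Product using (∃; _×_)
open import Relation.Binary.PropositionalEquality using (_≡_)
open import Relation.Nullary using (¬_; Dec)
open import Relation.Nullary.Decidable using (¬?)

record IsPartition {n : ℕ} (𝒫 : List (Subset n)) : Set where
  field
    nonempty : All Nonempty 𝒫
    cover    : ∀ (x : Fin n) → ∃ λ i → x ∈ lookup 𝒫 i
    disjoint : ∀ i j (x : Fin n) → x ∈ lookup 𝒫 i → x ∈ lookup 𝒫 j → i ≡ j

#parts : ∀ {n} → List (Subset n) → ℕ
#parts = length

Equitable : ∀ {n} → List (Subset n) → Set
Equitable {n} 𝒫 = ∃ λ (m : ℕ) → All (λ P → ∣ P ∣ ≡ m) 𝒫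

-- S ⊆_{1/2} T  :  |S ∖ T| < (1/2)|S|,  i.e.  2 |S ∖ T| < |S|.
_⊆½_ : ∀ {n} → Subset n → Subset n → Set
S ⊆½ T = 2 * ∣ S ─ T ∣ < ∣ S ∣

_⊆½?_ : ∀ {n} (S T : Subset n) → Dec (S ⊆½ T)
S ⊆½? T = 2 * ∣ S ─ T ∣ <? ∣ S ∣

_∈½_ : ∀ {n} → Subset n → List (Subset n) → Set
S ∈½ 𝒫 = Any (λ P → S ⊆½ P) 𝒫

-- 𝒬 ≺_{1/2} 𝒫 :  Σ_{Q ∈ 𝒬, Q ∉_{1/2} 𝒫} |Q| ≤ (1/2) n,  i.e.  2 * (that sum) ≤ n.
_≺½_ : ∀ {n} → List (Subset n) → List (Subset n) → Set
_≺½_ {n} 𝒬 𝒫 =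
  2 * sum (map ∣_∣ (filter (λ Q → ¬? (any? (Q ⊆½?_) 𝒫)) 𝒬)) ≤ n

-- Let every part of 𝒫 have size m, so that n = m|𝒫|. A part Q that is half-contained in
-- some P ∈ 𝒫 has |Q| ≤ |Q ∖ P| + |P| < |Q|/2 + m, hence |Q| < 2m. The parts of 𝒬 cover the
-- n points; those not half-contained in 𝒫 cover at most n/2 of them, so the remaining
-- ≥ n/2 points lie in parts of size < 2m, giving n/2 ≤ 2m|𝒬|. Thus m|𝒫| = n ≤ 4m|𝒬|.
module Submission where

open import Defs
open import Data.Nat using (ℕ; _+_; _*_; _≤_; _<_; z≤n; s≤s; >-nonZero)
open import Data.Nat.Properties
open import Data.Nat.Tactic.RingSolver using (solve-∀)
open import Algebra.Properties.CommutativeSemigroup +-commutativeSemigroup using (x∙yz≈y∙xz)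
open import Data.Nat.ListAction using (sum)
open import Data.Fin using (Fin; zero; suc)
import Data.Fin.Properties as Fin
open import Data.Fin.Subset using (Subset; _∈_; _∉_; _⊆_; _─_; _∪_; ∣_∣; ⋃; ⊤; Nonempty; inside; outside)
open import Data.Fin.Subset.Properties
  using (_∈?_; ∉⊥; ∣⊥∣≡0; ∣⊤∣≡n; ∣p∣≤n; p⊆q⇒∣p∣≤∣q∣; p⊆p∪q; q⊆p∪q; x∈p∪q⁻; x∈p∧x∉q⇒x∈p─q; x∈p⇒∣p-x∣<∣p∣)
open import Data.Vec using (_∷_; []; here; there)
open import Data.List using (List; []; _∷_; length; lookup; filter; map)
open import Data.List.Relation.Unary.All as All using (All; []; _∷_)
open import Data.List.Relation.Unary.Any as Any using (any?)
open import Data.Product using (∃; _,_; proj₁; proj₂)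
open import Data.Sum using (inj₁; inj₂)
open import Function using (_∘_)
open import Relation.Binary.PropositionalEquality using (_≡_; refl; sym; cong; cong₂; subst)
open import Relation.Nullary using (yes; no; contradiction)
open import Relation.Nullary.Decidable using (¬?)
open import Relation.Unary using (Decidable)

private
  variable
    n : ℕ

∣p∪q∣≤∣p∣+∣q∣ : (p q : Subset n) → ∣ p ∪ q ∣ ≤ ∣ p ∣ + ∣ q ∣
∣p∪q∣≤∣p∣+∣q∣ [] [] = z≤n
∣p∪q∣≤∣p∣+∣q∣ (outside ∷ p) (outside ∷ q) = ∣p∪q∣≤∣p∣+∣q∣ p q
∣p∪q∣≤∣p∣+∣q∣ (outside ∷ p) (inside ∷ q) =
  ≤-trans (s≤s (∣p∪q∣≤∣p∣+∣q∣ p q)) (≤-reflexive (sym (+-suc ∣ p ∣ ∣ q ∣)))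
∣p∪q∣≤∣p∣+∣q∣ (inside ∷ p) (outside ∷ q) = s≤s (∣p∪q∣≤∣p∣+∣q∣ p q)
∣p∪q∣≤∣p∣+∣q∣ (inside ∷ p) (inside ∷ q) =
  s≤s (≤-trans (∣p∪q∣≤∣p∣+∣q∣ p q) (+-monoʳ-≤ ∣ p ∣ (n≤1+n ∣ q ∣)))

∣p∣+∣q∣≤∣p∪q∣ : (p q : Subset n) → (∀ {x} → x ∈ p → x ∉ q) → ∣ p ∣ + ∣ q ∣ ≤ ∣ p ∪ q ∣
∣p∣+∣q∣≤∣p∪q∣ [] [] _ = z≤n
∣p∣+∣q∣≤∣p∪q∣ (outside ∷ p) (outside ∷ q) p∩q≡∅ =
  ∣p∣+∣q∣≤∣p∪q∣ p q (λ x∈p → p∩q≡∅ (there x∈p) ∘ there)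
∣p∣+∣q∣≤∣p∪q∣ (outside ∷ p) (inside ∷ q) p∩q≡∅ =
  ≤-trans (≤-reflexive (+-suc ∣ p ∣ ∣ q ∣))
          (s≤s (∣p∣+∣q∣≤∣p∪q∣ p q (λ x∈p → p∩q≡∅ (there x∈p) ∘ there)))
∣p∣+∣q∣≤∣p∪q∣ (inside ∷ p) (outside ∷ q) p∩q≡∅ =
  s≤s (∣p∣+∣q∣≤∣p∪q∣ p q (λ x∈p → p∩q≡∅ (there x∈p) ∘ there))
∣p∣+∣q∣≤∣p∪q∣ (inside ∷ p) (inside ∷ q) p∩q≡∅ = contradiction here (p∩q≡∅ here)

p⊆p─q∪q : (p q : Subset n) → p ⊆ (p ─ q) ∪ q
p⊆p─q∪q p q {x} x∈p with x ∈? q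
... | yes x∈q = q⊆p∪q (p ─ q) q x∈q
... | no  x∉q = p⊆p∪q q (x∈p∧x∉q⇒x∈p─q x∈p x∉q)

∣p∣≤∣p─q∣+∣q∣ : (p q : Subset n) → ∣ p ∣ ≤ ∣ p ─ q ∣ + ∣ q ∣
∣p∣≤∣p─q∣+∣q∣ p q = ≤-trans (p⊆q⇒∣p∣≤∣q∣ (p⊆p─q∪q p q)) (∣p∪q∣≤∣p∣+∣q∣ (p ─ q) q)

Nonempty⇒∣p∣>0 : {p : Subset n} → Nonempty p → 0 < ∣ p ∣
Nonempty⇒∣p∣>0 (_ , x∈p) = ≤-<-trans z≤n (x∈p⇒∣p-x∣<∣p∣ x∈p)

PairwiseDisjoint : List (Subset n) → Set
PairwiseDisjoint {n} ps = ∀ i j (x : Fin n) → x ∈ lookup ps i → x ∈ lookup ps j → i ≡ j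

x∈⋃⁺ : (ps : List (Subset n)) (i : Fin (length ps)) {x : Fin n} → x ∈ lookup ps i → x ∈ ⋃ ps
x∈⋃⁺ (p ∷ ps) zero    x∈p = p⊆p∪q (⋃ ps) x∈p
x∈⋃⁺ (p ∷ ps) (suc i) x∈p = q⊆p∪q p (⋃ ps) (x∈⋃⁺ ps i x∈p)

x∈⋃⁻ : (ps : List (Subset n)) {x : Fin n} → x ∈ ⋃ ps → ∃ λ i → x ∈ lookup ps i
x∈⋃⁻ []       x∈⊥ = contradiction x∈⊥ ∉⊥
x∈⋃⁻ (p ∷ ps) x∈⋃ with x∈p∪q⁻ p (⋃ ps) x∈⋃
... | inj₁ x∈p  = zero , x∈p
... | inj₂ x∈⋃ps with x∈⋃⁻ ps x∈⋃ps
...   | i , x∈pᵢ = suc i , x∈pᵢ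

∣⋃ps∣≤sum : (ps : List (Subset n)) → ∣ ⋃ ps ∣ ≤ sum (map ∣_∣ ps)
∣⋃ps∣≤sum {n} []   = ≤-reflexive (∣⊥∣≡0 n)
∣⋃ps∣≤sum (p ∷ ps) = ≤-trans (∣p∪q∣≤∣p∣+∣q∣ p (⋃ ps)) (+-monoʳ-≤ ∣ p ∣ (∣⋃ps∣≤sum ps))

sum≤∣⋃ps∣ : (ps : List (Subset n)) → PairwiseDisjoint ps → sum (map ∣_∣ ps) ≤ ∣ ⋃ ps ∣
sum≤∣⋃ps∣ []       _        = z≤n
sum≤∣⋃ps∣ (p ∷ ps) disjoint =
  ≤-trans (+-monoʳ-≤ ∣ p ∣ (sum≤∣⋃ps∣ ps disjoint-tail)) (∣p∣+∣q∣≤∣p∪q∣ p (⋃ ps) p∩⋃ps≡∅)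
  where
  disjoint-tail : PairwiseDisjoint ps
  disjoint-tail i j x x∈pᵢ x∈pⱼ = Fin.suc-injective (disjoint (suc i) (suc j) x x∈pᵢ x∈pⱼ)
  p∩⋃ps≡∅ : ∀ {x} → x ∈ p → x ∉ ⋃ ps
  p∩⋃ps≡∅ {x} x∈p x∈⋃ps with x∈⋃⁻ ps x∈⋃ps
  ... | j , x∈pⱼ with disjoint zero (suc j) x x∈p x∈pⱼ
  ... | ()

sum-∣partition∣≡n : {𝒫 : List (Subset n)} → IsPartition 𝒫 → sum (map ∣_∣ 𝒫) ≡ n
sum-∣partition∣≡n {n} {𝒫} 𝒫-partition = ≤-antisym
  (≤-trans (sum≤∣⋃ps∣ 𝒫 disjoint) (∣p∣≤n (⋃ 𝒫)))
  (begin
    n               ≡⟨ sym (∣⊤∣≡n n) ⟩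
    ∣ ⊤ {n} ∣       ≤⟨ p⊆q⇒∣p∣≤∣q∣ ⊤⊆⋃𝒫 ⟩
    ∣ ⋃ 𝒫 ∣         ≤⟨ ∣⋃ps∣≤sum 𝒫 ⟩
    sum (map ∣_∣ 𝒫) ∎)
  where
  open IsPartition 𝒫-partition
  open ≤-Reasoning
  ⊤⊆⋃𝒫 : ⊤ ⊆ ⋃ 𝒫
  ⊤⊆⋃𝒫 {x} _ = x∈⋃⁺ 𝒫 (proj₁ (cover x)) (proj₂ (cover x))

sum-map-const : ∀ {A : Set} {f : A → ℕ} {c : ℕ} {xs : List A} →
  All (λ x → f x ≡ c) xs → sum (map f xs) ≡ length xs * c
sum-map-const []           = refl
sum-map-const (fx≡c ∷ all) = cong₂ _+_ fx≡c (sum-map-const all)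

sum-map≤sum-filter-∁+length* : ∀ {A : Set} {P : A → Set} (P? : Decidable P) (f : A → ℕ) {c : ℕ} →
  (∀ {x} → P x → f x ≤ c) → (xs : List A) →
  sum (map f xs) ≤ sum (map f (filter (¬? ∘ P?) xs)) + length xs * c
sum-map≤sum-filter-∁+length* P? f bound [] = z≤n
sum-map≤sum-filter-∁+length* P? f {c} bound (x ∷ xs) with P? x
... | yes px = begin
  f x + sum (map f xs)       ≤⟨ +-mono-≤ (bound px) ih ⟩
  c + (rest + length xs * c) ≡⟨ x∙yz≈y∙xz c rest (length xs * c) ⟩
  rest + (c + length xs * c) ∎
  where
  open ≤-Reasoning
  rest = sum (map f (filter (¬? ∘ P?) xs))
  ih = sum-map≤sum-filter-∁+length* P? f bound xs
... | no _ = begin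
  f x + sum (map f xs)            ≤⟨ +-monoʳ-≤ (f x) ih ⟩
  f x + (rest + length xs * c)    ≡⟨ sym (+-assoc (f x) rest _) ⟩
  f x + rest + length xs * c      ≤⟨ +-monoʳ-≤ (f x + rest) (m≤n+m _ c) ⟩
  f x + rest + (c + length xs * c) ∎
  where
  open ≤-Reasoning
  rest = sum (map f (filter (¬? ∘ P?) xs))
  ih = sum-map≤sum-filter-∁+length* P? f bound xs

2*a<c∧c≤a+b⇒c<2*b : ∀ a b c → 2 * a < c → c ≤ a + b → c < 2 * b
2*a<c∧c≤a+b⇒c<2*b a b c 2a<c c≤a+b = +-cancelˡ-< c c (2 * b) (begin-strict
  c + c         ≡⟨ cong (c +_) (sym (+-identityʳ c)) ⟩
  2 * c         ≤⟨ *-monoʳ-≤ 2 c≤a+b ⟩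
  2 * (a + b)   ≡⟨ *-distribˡ-+ 2 a b ⟩
  2 * a + 2 * b <⟨ +-monoˡ-< (2 * b) 2a<c ⟩
  c + 2 * b     ∎)
  where open ≤-Reasoning

c≤a+b∧2*a≤c⇒c≤2*b : ∀ a b c → c ≤ a + b → 2 * a ≤ c → c ≤ 2 * b
c≤a+b∧2*a≤c⇒c≤2*b a b c c≤a+b 2a≤c = +-cancelˡ-≤ c c (2 * b) (begin
  c + c         ≡⟨ cong (c +_) (sym (+-identityʳ c)) ⟩
  2 * c         ≤⟨ *-monoʳ-≤ 2 c≤a+b ⟩
  2 * (a + b)   ≡⟨ *-distribˡ-+ 2 a b ⟩
  2 * a + 2 * b ≤⟨ +-monoˡ-≤ (2 * b) 2a≤c ⟩
  c + 2 * b     ∎)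
  where open ≤-Reasoning

⊆½⇒∣S∣<2*∣T∣ : (S T : Subset n) → S ⊆½ T → ∣ S ∣ < 2 * ∣ T ∣
⊆½⇒∣S∣<2*∣T∣ S T S⊆½T = 2*a<c∧c≤a+b⇒c<2*b (∣ S ─ T ∣) (∣ T ∣) (∣ S ∣) S⊆½T (∣p∣≤∣p─q∣+∣q∣ S T)

∈½⇒∣S∣<2*m : ∀ {m} {𝒫 : List (Subset n)} → All (λ P → ∣ P ∣ ≤ m) 𝒫 →
  (S : Subset n) → S ∈½ 𝒫 → ∣ S ∣ < 2 * m
∈½⇒∣S∣<2*m ∣𝒫∣≤m S S∈½𝒫 with All.lookupAny ∣𝒫∣≤m S∈½𝒫
... | ∣P∣≤m , S⊆½P = <-≤-trans (⊆½⇒∣S∣<2*∣T∣ S (Any.lookup S∈½𝒫) S⊆½P) (*-monoʳ-≤ 2 ∣P∣≤m)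

≺½⇒n≤4*#parts*m : ∀ {m} {𝒫 𝒬 : List (Subset n)} → IsPartition 𝒬 →
  All (λ P → ∣ P ∣ ≤ m) 𝒫 → 𝒬 ≺½ 𝒫 → n ≤ 4 * #parts 𝒬 * m
≺½⇒n≤4*#parts*m {n} {m} {𝒫} {𝒬} 𝒬-partition ∣𝒫∣≤m 𝒬≺½𝒫 = begin
  n                        ≤⟨ c≤a+b∧2*a≤c⇒c≤2*b unmatched (length 𝒬 * (2 * m)) n n≤unmatched+good 𝒬≺½𝒫 ⟩
  2 * (length 𝒬 * (2 * m)) ≡⟨ 2*[a*[2*b]]≡4*a*b (length 𝒬) m ⟩
  4 * length 𝒬 * m         ∎
  where
  open ≤-Reasoning
  2*[a*[2*b]]≡4*a*b : ∀ a b → 2 * (a * (2 * b)) ≡ 4 * a * b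
  2*[a*[2*b]]≡4*a*b = solve-∀
  unmatched : ℕ
  unmatched = sum (map ∣_∣ (filter (λ Q → ¬? (any? (Q ⊆½?_) 𝒫)) 𝒬))
  n≤unmatched+good : n ≤ unmatched + length 𝒬 * (2 * m)
  n≤unmatched+good = begin
    n                              ≡⟨ sum-∣partition∣≡n 𝒬-partition ⟨
    sum (map ∣_∣ 𝒬)                ≤⟨ sum-map≤sum-filter-∁+length* (λ Q → any? (Q ⊆½?_) 𝒫) ∣_∣
                                        (λ {Q} → <⇒≤ ∘ ∈½⇒∣S∣<2*m ∣𝒫∣≤m Q) 𝒬 ⟩
    unmatched + length 𝒬 * (2 * m) ∎

claim5 : ∀ (n : ℕ) (𝒫 𝒬 : List (Subset n)) →
    IsPartition 𝒫 → IsPartition 𝒬 → Equitable 𝒫 →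
    𝒬 ≺½ 𝒫 → #parts 𝒫 ≤ 4 * #parts 𝒬
claim5 n [] 𝒬 _ _ _ _ = z≤n
claim5 n 𝒫@(_ ∷ _) 𝒬 𝒫-partition 𝒬-partition (m , ∣𝒫∣≡m) 𝒬≺½𝒫 =
  *-cancelʳ-≤ (#parts 𝒫) (4 * #parts 𝒬) m ⦃ >-nonZero (m>0 (IsPartition.nonempty 𝒫-partition) ∣𝒫∣≡m) ⦄
    (begin
      #parts 𝒫 * m     ≡⟨ sum-map-const ∣𝒫∣≡m ⟨
      sum (map ∣_∣ 𝒫)  ≡⟨ sum-∣partition∣≡n 𝒫-partition ⟩
      n                ≤⟨ ≺½⇒n≤4*#parts*m 𝒬-partition (All.map ≤-reflexive ∣𝒫∣≡m) 𝒬≺½𝒫 ⟩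
      4 * #parts 𝒬 * m ∎)
  where
  open ≤-Reasoning
  m>0 : ∀ {P 𝒫′} → All Nonempty (P ∷ 𝒫′) → All (λ P → ∣ P ∣ ≡ m) (P ∷ 𝒫′) → 0 < m
  m>0 (P≢∅ ∷ _) (∣P∣≡m ∷ _) = subst (0 <_) ∣P∣≡m (Nonempty⇒∣p∣>0 P≢∅)
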